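{- Let $j^{\operatorname{last}}_{m,k}(312)$ be the number of $312$-avoiding Jacobi permutations $\pi\in\mathfrak{S}_m$ whose last letter equals $k$. For all $n\geq k\geq1$, \[ j^{\operatorname{last}}_{2n,2k-1}(312)=\frac{\binom{3k-3}{k-1}\binom{3n-3k+1}{n-k+1}}{(2k-1)(2n-2k+1)}\qquad\text{and}\qquad j^{\operatorname{last}}_{2n+1,2k}(312)=\frac{\binom{3k-2}{k}\binom{3n-3k+1}{n-k+1}}{(2k-1)(2n-2k+1)}. \] In addition, $j^{\operatorname{last}}_{2n+1,1}(312)=\frac{1}{2n+1}\binom{3n}{n}$ for all $n\geq0$, and, for $k\neq1$, $j^{\operatorname{last}}_{n,k}(312)=0$ whenever $n$ and $k$ have the same parity.
   Context: A permutation of a finite set $S$ of positive integers is a word in which each element of $S$ appears exactly once; $\mathfrak{S}_m$ is the set of permutations of $\{1,\dots,m\}$. For a permutation $\pi$ and a letter $x$ of $\pi$, $\rho_\pi(x)$ is the maximal consecutive subword of $\pi$ consisting of the letters immediately to the right of $x$ that are all larger than $x$. $\pi$ is Jacobi if $|\rho_\pi(x)|$ is even for all letters $x$. A permutation $\pi$ avoids a pattern $\sigma$ if no subword of $\pi$ has standardization (relative order) $\sigma$. -}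

module Defs where

open import Data.Bool using (Bool; true; false; _∧_; _∨_; not; T)
open import Data.Nat using (ℕ; zero; suc; _≡ᵇ_; _<ᵇ_; _≤ᵇ_)
open import Data.List using (List; []; _∷_; length; takeWhileᵇ; last)
open import Data.Bool.ListAction using (any; all)
open import Data.Maybe using (Maybe; just; nothing)
open import Data.Fin using (Fin)
open import Data.Product using (Σ)
open import Function.Bundles using (_↔_)

evenᵇ : ℕ → Bool
evenᵇ zero = true
evenᵇ (suc n) = not (evenᵇ n)

distinctᵇ : List ℕ → Bool
distinctᵇ [] = true
distinctᵇ (x ∷ xs) = not (any (λ y → x ≡ᵇ y) xs) ∧ distinctᵇ xs

isPermᵇ : ℕ → List ℕ → Bool
isPermᵇ m π = (length π ≡ᵇ m) ∧ distinctᵇ π ∧ all (λ x → (1 ≤ᵇ x) ∧ (x ≤ᵇ m)) π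

-- ρ_π(x) for the occurrence of x at the head of a suffix  x ∷ rest  of π:
-- the maximal run of letters immediately right of x that are all larger than x
ρ : ℕ → List ℕ → List ℕ
ρ x rest = takeWhileᵇ (λ y → x <ᵇ y) rest

jacobiᵇ : List ℕ → Bool
jacobiᵇ [] = true
jacobiᵇ (x ∷ rest) = evenᵇ (length (ρ x rest)) ∧ jacobiᵇ rest

-- π contains 312: positions i < j < l with π_j < π_l < π_i
-- (c, b) with b < c < a, b appearing before c, in the list
has12belowᵇ : ℕ → List ℕ → Bool
has12belowᵇ a [] = false
has12belowᵇ a (b ∷ rest) = any (λ c → (b <ᵇ c) ∧ (c <ᵇ a)) rest ∨ has12belowᵇ a rest

contains312ᵇ : List ℕ → Bool
contains312ᵇ [] = false
contains312ᵇ (a ∷ rest) = has12belowᵇ a rest ∨ contains312ᵇ rest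

avoids312ᵇ : List ℕ → Bool
avoids312ᵇ π = not (contains312ᵇ π)

lastIsᵇ : ℕ → List ℕ → Bool
lastIsᵇ k π with last π
... | just x = x ≡ᵇ k
... | nothing = false

JLast : ℕ → ℕ → List ℕ → Set
JLast m k π = T (isPermᵇ m π ∧ jacobiᵇ π ∧ avoids312ᵇ π ∧ lastIsᵇ k π)

-- j^last_{m,k}(312) = N : the set of such π is in bijection with Fin N
-- (JLast m k π is a proposition, being T of a boolean)
jlast≡ : ℕ → ℕ → ℕ → Set
jlast≡ m k N = Fin N ↔ Σ (List ℕ) (JLast m k)

-- Let π be a 312-avoiding permutation of size m ending in k. A letter above k cannot precede a
-- letter below k (with k they would form a 312), so π = α (γ + k) k with α a 312-avoiding
-- permutation of size a = k − 1 and γ one of size b = m − k; conversely every such word avoids 312.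
-- The Jacobi property splits the same way, except that the last letter of a nonempty α sees the
-- whole block (γ + k) k, which must therefore have even length. Hence j^last_{a+b+1,a+1} = jₐ j_b
-- if a = 0 or b is odd and 0 otherwise, where jₘ counts 312-avoiding Jacobi permutations of size m.
-- In particular for k ≠ 1 the sizes m = k + b and k have opposite parities. Summing over the last
-- letter, jₘ₊₁ = Σ_{a+b=m} j^last_{m+1,a+1}, which is solved by j_{2n} = F₁(n), j_{2n+1} = F₂(n) for
-- the Fuss–Catalan numbers Fᵣ(n) = [xⁿ] T(x)ʳ, T = 1 + x T³, and Fᵣ(n) = r/(3n + r) C(3n + r, n).

module Submission where

open import Defs
open import Algebra.Properties.CommutativeSemigroup as CommSemigroupProperties using ()
open import Data.Bool using (Bool; true; false; _∧_; _∨_; not; T; if_then_else_)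
open import Data.Bool.ListAction using (all; any)
open import Data.Bool.Properties
  using (T-∧; T-not-≡; T-irrelevant; not-¬; ∧-assoc; ∧-zeroʳ; ∨-assoc; ∨-identityʳ; ∨-zeroʳ)
open import Data.Empty using (⊥; ⊥-elim)
open import Data.Fin using (Fin; zero; suc)
open import Data.List
  using (List; []; _∷_; _++_; _∷ʳ_; map; length; lookup; filter; takeWhileᵇ; last; initLast; _∷ʳ′_;
         cartesianProductWith)
open import Data.List.Properties
  using (∷-injective; ∷ʳ-injective; ∷ʳ-++; ++-assoc; ++-identityʳ; length-++; length-map; map-injective;
         filter-all; filter-accept; filter-reject)
open import Data.List.Membership.Propositional using (_∈_)
open import Data.List.Membership.Propositional.Properties
  using (∈-++⁺ˡ; ∈-++⁺ʳ; ∈-++⁻; ∈-map⁻; ∈-lookup; ∈-cartesianProductWith⁺; ∈-cartesianProductWith⁻)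
open import Data.List.Membership.Propositional.Properties.WithK using (unique⇒irrelevant)
open import Data.List.Relation.Unary.All as All using (All; []; _∷_)
import Data.List.Relation.Unary.All.Properties as AllP
open import Data.List.Relation.Unary.AllPairs using ([]; _∷_)
open import Data.List.Relation.Unary.Any using (here; there; index)
open import Data.List.Relation.Unary.Any.Properties using (lookup-index)
open import Data.List.Relation.Unary.Unique.Propositional using (Unique)
import Data.List.Relation.Unary.Unique.Propositional.Properties as UP
open import Data.Maybe using (just)
open import Data.Nat
  using (ℕ; zero; suc; _+_; _*_; _∸_; _<_; _≤_; _<ᵇ_; _≤ᵇ_; _≡ᵇ_; z≤n; s≤s; ⌊_/2⌋)
open import Data.Nat.Combinatorics using (_C_; nC1≡n; nCk+nC[k+1]≡[n+1]C[k+1])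
open import Data.Nat.Properties
  using (+-comm; +-assoc; +-suc; +-identityʳ; *-identityˡ; *-identityʳ; *-zeroʳ; *-assoc; *-distribˡ-+; *-distribʳ-+; *-distribˡ-∸;
         +-cancelˡ-≡; +-cancelʳ-≡; *-cancelˡ-≡; suc-injective; +-commutativeSemigroup; *-commutativeSemigroup;
         ≤-refl; ≤-reflexive; ≤-trans; ≤-antisym; ≤-pred; <⇒≤; <-trans; <-irrefl; <⇒≱; ≮⇒≥; ≰⇒>; ≤∧≢⇒<;
         _≤?_; _<?_; m≤m+n; m≤n+m; n≤1+n; m<m+n; n≢0⇒n>0; +-monoʳ-≤; +-cancelˡ-≤;
         m+n∸m≡n; m+[n∸m]≡n; m+n≤o⇒m≤o∸n; m≤o∸n⇒m+n≤o;
         ≡ᵇ⇒≡; ≡⇒≡ᵇ; ≤ᵇ⇒≤; ≤⇒≤ᵇ; <⇒<ᵇ; n≡⌊n+n/2⌋)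
open import Data.Nat.Tactic.RingSolver using (solve-∀)
open import Data.Product using (Σ; _×_; _,_; proj₁; proj₂; ∃; ∃₂)
open import Data.Sum using (_⊎_; inj₁; inj₂)
open import Data.Unit using (tt)
open import Function using (_∘_; _∘′_)
open import Function.Bundles using (Equivalence; _⇔_; mk⇔; _↔_; mk↔ₛ′)
open import Relation.Nullary using (¬_; yes; no; contradiction)
open import Relation.Binary.PropositionalEquality
  using (_≡_; _≢_; refl; sym; trans; cong; cong₂; subst; subst₂; module ≡-Reasoning)
open ≡-Reasoning
open CommSemigroupProperties +-commutativeSemigroup using () renaming (interchange to +-interchange)
open CommSemigroupProperties *-commutativeSemigroup using () renaming (interchange to *-interchange)

-- Fuss–Catalan numbers

-- fussCatalan r n = [xⁿ] T(x)ʳ for the ternary-tree series T = 1 + x T³, by Tʳ⁺¹ = Tʳ + x Tʳ⁺³.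
fussCatalan : ℕ → ℕ → ℕ
fussCatalan r       zero    = 1
fussCatalan zero    (suc n) = 0
fussCatalan (suc r) (suc n) = fussCatalan r (suc n) + fussCatalan (3 + r) n

fussCatalan-1 : ∀ r → fussCatalan r 1 ≡ r
fussCatalan-1 zero    = refl
fussCatalan-1 (suc r) = trans (cong (_+ 1) (fussCatalan-1 r)) (+-comm r 1)

pascal : ∀ n k → suc n C suc k ≡ n C k + n C suc k
pascal n k = sym (nCk+nC[k+1]≡[n+1]C[k+1] n k)

[1+k]*[1+n]C[1+k]≡[1+n]*nCk : ∀ n k → suc k * (suc n C suc k) ≡ suc n * (n C k)
[1+k]*[1+n]C[1+k]≡[1+n]*nCk zero    zero    = refl
[1+k]*[1+n]C[1+k]≡[1+n]*nCk zero    (suc k) = *-zeroʳ (suc (suc k))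
[1+k]*[1+n]C[1+k]≡[1+n]*nCk (suc n) zero    =
  trans (+-identityʳ _) (trans (nC1≡n (suc (suc n))) (sym (*-identityʳ (suc (suc n)))))
[1+k]*[1+n]C[1+k]≡[1+n]*nCk (suc n) (suc k) = begin
  suc (suc k) * (suc (suc n) C suc (suc k))   ≡⟨ cong (suc (suc k) *_) (pascal (suc n) (suc k)) ⟩
  suc (suc k) * (X + Y)                       ≡⟨ regroup k X Y ⟩
  X + (suc k * X + suc (suc k) * Y)           ≡⟨ cong₂ (λ u v → X + (u + v)) ([1+k]*[1+n]C[1+k]≡[1+n]*nCk n k)
                                                                             ([1+k]*[1+n]C[1+k]≡[1+n]*nCk n (suc k)) ⟩
  X + (suc n * (n C k) + suc n * (n C suc k)) ≡⟨ cong (X +_) (*-distribˡ-+ (suc n) (n C k) (n C suc k)) ⟨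
  X + suc n * (n C k + n C suc k)             ≡⟨ cong (λ u → X + suc n * u) (pascal n k) ⟨
  suc (suc n) * X                             ∎
  where
  X = suc n C suc k
  Y = suc n C suc (suc k)
  regroup : ∀ k x y → suc (suc k) * (x + y) ≡ x + (suc k * x + suc (suc k) * y)
  regroup = solve-∀

[1+k]*nC[1+k]≡[n-k]*nCk : ∀ k d {n} → k + suc d ≡ n → suc k * (n C suc k) ≡ suc d * (n C k)
[1+k]*nC[1+k]≡[n-k]*nCk k d {n} refl = +-cancelˡ-≡ (suc k * (n C k)) _ _ (begin
  suc k * (n C k) + suc k * (n C suc k) ≡⟨ *-distribˡ-+ (suc k) (n C k) (n C suc k) ⟨
  suc k * (n C k + n C suc k)           ≡⟨ cong (suc k *_) (pascal n k) ⟨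
  suc k * (suc n C suc k)               ≡⟨ [1+k]*[1+n]C[1+k]≡[1+n]*nCk n k ⟩
  (suc k + suc d) * (n C k)             ≡⟨ *-distribʳ-+ (n C k) (suc k) (suc d) ⟩
  suc k * (n C k) + suc d * (n C k)     ∎)

-- The ballot form Fᵣ(n+1) = C(M, n+1) − 2 C(M, n), M = r + 3n + 2, with the subtraction moved across.
fussCatalan-ballot : ∀ n r {M} → r + 3 * n + 2 ≡ M → fussCatalan r (suc n) + 2 * (M C n) ≡ M C suc n
fussCatalan-ballot n zero {M} refl = *-cancelˡ-≡ _ _ (suc n) (begin
  suc n * (2 * (M C n))     ≡⟨ regroup n (M C n) ⟩
  suc (2 * n + 1) * (M C n) ≡⟨ [1+k]*nC[1+k]≡[n-k]*nCk n (2 * n + 1) (size n) ⟨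
  suc n * (M C suc n)       ∎)
  where
  regroup : ∀ n c → suc n * (2 * c) ≡ suc (2 * n + 1) * c
  regroup = solve-∀
  size : ∀ n → n + suc (2 * n + 1) ≡ 0 + 3 * n + 2
  size = solve-∀
fussCatalan-ballot zero (suc r) refl = begin
  fussCatalan r 1 + 1 + 2 ≡⟨ cong (λ f → f + 1 + 2) (fussCatalan-1 r) ⟩
  r + 1 + 2              ≡⟨ size r ⟩
  suc r + 0 + 2          ≡⟨ nC1≡n (suc r + 0 + 2) ⟨
  (suc r + 0 + 2) C 1    ∎
  where
  size : ∀ r → r + 1 + 2 ≡ suc r + 0 + 2
  size = solve-∀
fussCatalan-ballot (suc n) (suc r) {suc M} refl = begin
  (A + B) + 2 * (suc M C suc n)             ≡⟨ cong (λ c → (A + B) + 2 * c) (pascal M n) ⟩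
  (A + B) + 2 * (M C n + M C suc n)         ≡⟨ regroup A B (M C n) (M C suc n) ⟩
  (A + 2 * (M C suc n)) + (B + 2 * (M C n)) ≡⟨ cong₂ _+_ (fussCatalan-ballot (suc n) r refl)
                                                        (fussCatalan-ballot n (3 + r) (size r n)) ⟩
  M C suc (suc n) + M C suc n               ≡⟨ +-comm (M C suc (suc n)) (M C suc n) ⟩
  M C suc n + M C suc (suc n)               ≡⟨ pascal M (suc n) ⟨
  suc M C suc (suc n)                       ∎
  where
  A = fussCatalan r (suc (suc n))
  B = fussCatalan (3 + r) (suc n)
  regroup : ∀ a b c d → (a + b) + 2 * (c + d) ≡ (a + 2 * d) + (b + 2 * c)
  regroup = solve-∀
  size : ∀ r n → 3 + r + 3 * n + 2 ≡ r + 3 * suc n + 2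
  size = solve-∀

fussCatalan-closed : ∀ n r {M} → r + 3 * n + 2 ≡ M → suc n * fussCatalan r (suc n) ≡ r * (M C n)
fussCatalan-closed n r {M} refl = +-cancelʳ-≡ (suc n * (2 * (M C n))) _ _ (begin
  suc n * F + suc n * (2 * (M C n))   ≡⟨ *-distribˡ-+ (suc n) F (2 * (M C n)) ⟨
  suc n * (F + 2 * (M C n))           ≡⟨ cong (suc n *_) (fussCatalan-ballot n r refl) ⟩
  suc n * (M C suc n)                 ≡⟨ [1+k]*nC[1+k]≡[n-k]*nCk n (r + 2 * n + 1) (size n r) ⟩
  suc (r + 2 * n + 1) * (M C n)       ≡⟨ regroup r n (M C n) ⟩
  r * (M C n) + suc n * (2 * (M C n)) ∎)
  where
  F = fussCatalan r (suc n)
  size : ∀ n r → n + suc (r + 2 * n + 1) ≡ r + 3 * n + 2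
  size = solve-∀
  regroup : ∀ r n c → suc (r + 2 * n + 1) * c ≡ r * c + suc n * (2 * c)
  regroup = solve-∀

fussCatalan₁-closed : ∀ n → fussCatalan 1 n * (2 * n + 1) ≡ (3 * n) C n
fussCatalan₁-closed zero    = refl
fussCatalan₁-closed (suc n) = *-cancelˡ-≡ _ _ (suc n) (begin
  suc n * (F * (2 * suc n + 1)) ≡⟨ regroup n F ⟩
  suc (2 * n + 2) * (suc n * F) ≡⟨ cong (suc (2 * n + 2) *_) (fussCatalan-closed n 1 (size₁ n)) ⟩
  suc (2 * n + 2) * (1 * c₀)    ≡⟨ cong (suc (2 * n + 2) *_) (*-identityˡ c₀) ⟩
  suc (2 * n + 2) * c₀          ≡⟨ [1+k]*nC[1+k]≡[n-k]*nCk n (2 * n + 2) (size₂ n) ⟨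
  suc n * (3 * suc n C suc n)   ∎)
  where
  F = fussCatalan 1 (suc n)
  c₀ = 3 * suc n C n
  regroup : ∀ n f → suc n * (f * (2 * suc n + 1)) ≡ suc (2 * n + 2) * (suc n * f)
  regroup = solve-∀
  size₁ : ∀ n → 1 + 3 * n + 2 ≡ 3 * suc n
  size₁ = solve-∀
  size₂ : ∀ n → n + suc (2 * n + 2) ≡ 3 * suc n
  size₂ = solve-∀

fussCatalan₂-closed : ∀ n → fussCatalan 2 n * (2 * n + 1) ≡ (3 * n + 1) C suc n
fussCatalan₂-closed zero    = refl
fussCatalan₂-closed (suc n) = *-cancelˡ-≡ _ _ (suc n * suc (suc n)) (begin
  suc n * suc (suc n) * (F * (2 * suc n + 1)) ≡⟨ regroup₁ n F ⟩
  suc (suc n) * suc (2 * n + 2) * (suc n * F) ≡⟨ cong (suc (suc n) * suc (2 * n + 2) *_) (fussCatalan-closed n 2 (size₀ n)) ⟩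
  suc (suc n) * suc (2 * n + 2) * (2 * c₀)    ≡⟨ regroup₂ n c₀ ⟩
  suc (2 * n + 2) * (suc (2 * n + 3) * c₀)    ≡⟨ cong (suc (2 * n + 2) *_) ([1+k]*nC[1+k]≡[n-k]*nCk n (2 * n + 3) (size₁ n)) ⟨
  suc (2 * n + 2) * (suc n * c₁)              ≡⟨ regroup₃ n c₁ ⟩
  suc n * (suc (2 * n + 2) * c₁)              ≡⟨ cong (suc n *_) ([1+k]*nC[1+k]≡[n-k]*nCk (suc n) (2 * n + 2) (size₂ n)) ⟨
  suc n * (suc (suc n) * c₂)                  ≡⟨ *-assoc (suc n) (suc (suc n)) c₂ ⟨
  suc n * suc (suc n) * c₂                    ∎)
  where
  F = fussCatalan 2 (suc n)
  c₀ = (3 * suc n + 1) C n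
  c₁ = (3 * suc n + 1) C suc n
  c₂ = (3 * suc n + 1) C suc (suc n)
  size₀ : ∀ n → 2 + 3 * n + 2 ≡ 3 * suc n + 1
  size₀ = solve-∀
  size₁ : ∀ n → n + suc (2 * n + 3) ≡ 3 * suc n + 1
  size₁ = solve-∀
  size₂ : ∀ n → suc n + suc (2 * n + 2) ≡ 3 * suc n + 1
  size₂ = solve-∀
  regroup₁ : ∀ n f → suc n * suc (suc n) * (f * (2 * suc n + 1)) ≡ suc (suc n) * suc (2 * n + 2) * (suc n * f)
  regroup₁ = solve-∀
  regroup₂ : ∀ n c → suc (suc n) * suc (2 * n + 2) * (2 * c) ≡ suc (2 * n + 2) * (suc (2 * n + 3) * c)
  regroup₂ = solve-∀
  regroup₃ : ∀ n c → suc (2 * n + 2) * (suc n * c) ≡ suc n * (suc (2 * n + 2) * c)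
  regroup₃ = solve-∀

antidiagonalSum : ℕ → (ℕ → ℕ → ℕ) → ℕ
antidiagonalSum zero    f = f 0 0
antidiagonalSum (suc m) f = f 0 (suc m) + antidiagonalSum m (λ a → f (suc a))

antidiagonalSum-cong : ∀ m {f g} → (∀ a b → a + b ≡ m → f a b ≡ g a b) → antidiagonalSum m f ≡ antidiagonalSum m g
antidiagonalSum-cong zero    f≗g = f≗g 0 0 refl
antidiagonalSum-cong (suc m) f≗g =
  cong₂ _+_ (f≗g 0 (suc m) refl) (antidiagonalSum-cong m (λ a b a+b≡m → f≗g (suc a) b (cong suc a+b≡m)))

antidiagonalSum-+ : ∀ m f g → antidiagonalSum m (λ a b → f a b + g a b) ≡ antidiagonalSum m f + antidiagonalSum m g
antidiagonalSum-+ zero    f g = refl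
antidiagonalSum-+ (suc m) f g rewrite antidiagonalSum-+ m (λ a → f (suc a)) (λ a → g (suc a)) =
  +-interchange (f 0 (suc m)) (g 0 (suc m)) _ _

antidiagonalSum-zero : ∀ m → antidiagonalSum m (λ _ _ → 0) ≡ 0
antidiagonalSum-zero zero    = refl
antidiagonalSum-zero (suc m) = antidiagonalSum-zero m

fussCatalan-convolution : ∀ r s n →
  antidiagonalSum n (λ a b → fussCatalan r a * fussCatalan s b) ≡ fussCatalan (r + s) n
fussCatalan-convolution zero    s zero    = refl
fussCatalan-convolution zero    s (suc n) = trans (cong₂ _+_ (+-identityʳ (fussCatalan s (suc n))) (antidiagonalSum-zero n)) (+-identityʳ _)
fussCatalan-convolution (suc r) s zero    = refl
fussCatalan-convolution (suc r) s (suc n) = begin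
  1 * F s (suc n) + ∑ (λ a b → (F r (suc a) + F (3 + r) a) * F s b)
    ≡⟨ cong (1 * F s (suc n) +_) (trans (antidiagonalSum-cong n λ a b _ → *-distribʳ-+ (F s b) (F r (suc a)) (F (3 + r) a))
                                        (antidiagonalSum-+ n _ _)) ⟩
  1 * F s (suc n) + (∑ (λ a b → F r (suc a) * F s b) + ∑ (λ a b → F (3 + r) a * F s b))
    ≡⟨ +-assoc (1 * F s (suc n)) _ _ ⟨
  (1 * F s (suc n) + ∑ (λ a b → F r (suc a) * F s b)) + ∑ (λ a b → F (3 + r) a * F s b)
    ≡⟨ cong₂ _+_ (fussCatalan-convolution r s (suc n)) (fussCatalan-convolution (3 + r) s n) ⟩
  F (r + s) (suc n) + F (3 + r + s) n ∎
  where
  F = fussCatalan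
  ∑ = antidiagonalSum n

antidiagonalSum-odd : ∀ n f →
  antidiagonalSum (suc (n + n)) f ≡ antidiagonalSum n (λ i j → f (i + i) (suc (j + j)) + f (suc (i + i)) (j + j))
antidiagonalSum-odd zero    f = refl
antidiagonalSum-odd (suc n) f rewrite +-suc n n = begin
  f 0 (3 + (n + n)) + (f 1 (2 + (n + n)) + antidiagonalSum (suc (n + n)) g)
    ≡⟨ +-assoc (f 0 (3 + (n + n))) _ _ ⟨
  first-two + antidiagonalSum (suc (n + n)) g
    ≡⟨ cong (first-two +_) (antidiagonalSum-odd n g) ⟩
  first-two + antidiagonalSum n (λ i j → g (i + i) (suc (j + j)) + g (suc (i + i)) (j + j))
    ≡⟨ cong (first-two +_) (antidiagonalSum-cong n λ i j _ →
         cong (λ x → f x (suc (j + j)) + f (suc x) (j + j)) (sym (+-suc (suc i) i))) ⟩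
  first-two + antidiagonalSum n (λ i j → f (suc i + suc i) (suc (j + j)) + f (suc (suc i + suc i)) (j + j)) ∎
  where
  g = λ a → f (2 + a)
  first-two = f 0 (3 + (n + n)) + f 1 (2 + (n + n))

antidiagonalSum-even : ∀ n f → antidiagonalSum (suc n + suc n) f ≡
  f 0 (suc n + suc n) + antidiagonalSum n (λ i j → f (suc (i + i)) (suc (j + j)) + f (suc (suc (i + i))) (j + j))
antidiagonalSum-even n f rewrite +-suc n n = cong (f 0 (2 + (n + n)) +_) (antidiagonalSum-odd n (λ a → f (suc a)))

module _ {A : Set} where

  Unique-++⁻ : ∀ xs {ys : List A} → Unique (xs ++ ys) → Unique xs × Unique ys
  Unique-++⁻ []       u               = [] , u
  Unique-++⁻ (x ∷ xs) (x∉xs++ys ∷ u) =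
    let u-xs , u-ys = Unique-++⁻ xs u in (AllP.++⁻ˡ xs x∉xs++ys ∷ u-xs) , u-ys

  Unique-∷ʳ⁻ : ∀ xs {y : A} → Unique (xs ∷ʳ y) → All (_≢ y) xs
  Unique-∷ʳ⁻ []       _              = []
  Unique-∷ʳ⁻ (x ∷ xs) (x∉xs∷ʳy ∷ u) = All.head (AllP.++⁻ʳ xs x∉xs∷ʳy) ∷ Unique-∷ʳ⁻ xs u

  Unique-map⁺-on : ∀ {B : Set} (g : A → B) {xs} → (∀ {x y} → x ∈ xs → y ∈ xs → g x ≡ g y → x ≡ y) →
    Unique xs → Unique (map g xs)
  Unique-map⁺-on g          inj []         = []
  Unique-map⁺-on g {x ∷ xs} inj (x∉xs ∷ u) =
    AllP.map⁺ (All.tabulate (λ y∈xs gx≡gy → All.lookup x∉xs y∈xs (inj (here refl) (there y∈xs) gx≡gy)))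
    ∷ Unique-map⁺-on g (λ x∈ y∈ → inj (there x∈) (there y∈)) u

  ++-cancel-length : ∀ (xs xs′ : List A) {ys ys′} → length xs ≡ length xs′ → xs ++ ys ≡ xs′ ++ ys′ →
    xs ≡ xs′ × ys ≡ ys′
  ++-cancel-length []       []         _   eq = refl , eq
  ++-cancel-length (x ∷ xs) (x′ ∷ xs′) len eq with x≡x′ , eq′ ← ∷-injective eq =
    let xs≡xs′ , ys≡ys′ = ++-cancel-length xs xs′ (suc-injective len) eq′ in cong₂ _∷_ x≡x′ xs≡xs′ , ys≡ys′

  last-∷ʳ : ∀ xs (x : A) → last (xs ∷ʳ x) ≡ just x
  last-∷ʳ []           x = refl
  last-∷ʳ (y ∷ [])     x = refl
  last-∷ʳ (y ∷ z ∷ xs) x = last-∷ʳ (z ∷ xs) x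

  index-∈-lookup : ∀ (xs : List A) i → index (∈-lookup {xs = xs} i) ≡ i
  index-∈-lookup (x ∷ xs) zero    = refl
  index-∈-lookup (x ∷ xs) (suc i) = cong suc (index-∈-lookup xs i)

  Fin-length↔ : ∀ (P : A → Set) {xs} → (∀ {x} (p q : P x) → p ≡ q) → Unique xs →
    (∀ {x} → x ∈ xs → P x) → (∀ {x} → P x → x ∈ xs) → Fin (length xs) ↔ Σ A P
  Fin-length↔ P {xs} P-irrelevant unique sound complete = mk↔ₛ′
    (λ i → lookup xs i , sound (∈-lookup i))
    (λ (x , p) → index (complete p))
    (λ (x , p) → Σ-≡ (sym (lookup-index (complete p))))
    (λ i → trans (cong index (unique⇒irrelevant unique (complete (sound (∈-lookup i))) (∈-lookup i)))
                 (index-∈-lookup xs i))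
    where
    Σ-≡ : ∀ {x y} {p : P x} {q : P y} → x ≡ y → (x , p) ≡ (y , q)
    Σ-≡ refl = cong (_ ,_) (P-irrelevant _ _)

  antidiagonalConcat : ℕ → (ℕ → ℕ → List A) → List A
  antidiagonalConcat zero    h = h 0 0
  antidiagonalConcat (suc m) h = h 0 (suc m) ++ antidiagonalConcat m (λ a → h (suc a))

  length-antidiagonalConcat : ∀ m h → length (antidiagonalConcat m h) ≡ antidiagonalSum m (λ a b → length (h a b))
  length-antidiagonalConcat zero    h = refl
  length-antidiagonalConcat (suc m) h =
    trans (length-++ (h 0 (suc m))) (cong (length (h 0 (suc m)) +_) (length-antidiagonalConcat m (λ a → h (suc a))))

  ∈-antidiagonalConcat⁻ : ∀ m h {x} → x ∈ antidiagonalConcat m h → ∃₂ λ a b → a + b ≡ m × x ∈ h a b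
  ∈-antidiagonalConcat⁻ zero    h x∈ = 0 , 0 , refl , x∈
  ∈-antidiagonalConcat⁻ (suc m) h x∈ with ∈-++⁻ (h 0 (suc m)) x∈
  ... | inj₁ x∈h = 0 , suc m , refl , x∈h
  ... | inj₂ x∈rest with a , b , a+b≡m , x∈h ← ∈-antidiagonalConcat⁻ m (λ a → h (suc a)) x∈rest =
    suc a , b , cong suc a+b≡m , x∈h

  ∈-antidiagonalConcat⁺ : ∀ m h {x} a b → a + b ≡ m → x ∈ h a b → x ∈ antidiagonalConcat m h
  ∈-antidiagonalConcat⁺ zero    h zero    zero     refl x∈h = x∈h
  ∈-antidiagonalConcat⁺ (suc m) h zero    .(suc m) refl x∈h = ∈-++⁺ˡ x∈h
  ∈-antidiagonalConcat⁺ (suc m) h (suc a) b a+b≡1+m x∈h =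
    ∈-++⁺ʳ (h 0 (suc m)) (∈-antidiagonalConcat⁺ m (λ a → h (suc a)) a b (suc-injective a+b≡1+m) x∈h)

  Unique-antidiagonalConcat : ∀ m h → (∀ a b → Unique (h a b)) →
    (∀ a b a′ b′ {x} → x ∈ h a b → x ∈ h a′ b′ → a ≡ a′) → Unique (antidiagonalConcat m h)
  Unique-antidiagonalConcat zero    h u disjoint = u 0 0
  Unique-antidiagonalConcat (suc m) h u disjoint = UP.++⁺ (u 0 (suc m))
    (Unique-antidiagonalConcat m (λ a → h (suc a)) (λ a → u (suc a))
       (λ a b a′ b′ x∈h x∈h′ → suc-injective (disjoint (suc a) b (suc a′) b′ x∈h x∈h′)))
    λ (x∈h₀ , x∈rest) → let a , b , _ , x∈h = ∈-antidiagonalConcat⁻ m (λ a → h (suc a)) x∈rest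
                        in contradiction (disjoint 0 (suc m) (suc a) b x∈h₀ x∈h) λ ()

module _ {A B C : Set} (f : A → B → C) where

  length-cartesianProductWith : ∀ xs ys → length (cartesianProductWith f xs ys) ≡ length xs * length ys
  length-cartesianProductWith []       ys = refl
  length-cartesianProductWith (x ∷ xs) ys =
    trans (length-++ (map (f x) ys)) (cong₂ _+_ (length-map (f x) ys) (length-cartesianProductWith xs ys))

  Unique-cartesianProductWith : ∀ {xs ys} →
    (∀ {w x y z} → w ∈ xs → x ∈ xs → y ∈ ys → z ∈ ys → f w y ≡ f x z → w ≡ x × y ≡ z) →
    Unique xs → Unique ys → Unique (cartesianProductWith f xs ys)
  Unique-cartesianProductWith          inj []            u-ys = []
  Unique-cartesianProductWith {x ∷ xs} {ys} inj (x∉xs ∷ u-xs) u-ys = UP.++⁺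
    (Unique-map⁺-on (f x) (λ y∈ z∈ → proj₂ ∘ inj (here refl) (here refl) y∈ z∈) u-ys)
    (Unique-cartesianProductWith (λ w∈ x∈ → inj (there w∈) (there x∈)) u-xs u-ys)
    λ (v∈map , v∈rest) →
      let y , y∈ , v≡fxy = ∈-map⁻ (f x) v∈map
          w , z , w∈ , z∈ , v≡fwz = ∈-cartesianProductWith⁻ f xs ys v∈rest
      in All.lookup x∉xs w∈ (proj₁ (inj (here refl) (there w∈) y∈ z∈ (trans (sym v≡fxy) v≡fwz)))

-- The Jacobi property and 312-containment of words

T-∧⁺ : ∀ {a b} → T a → T b → T (a ∧ b)
T-∧⁺ ta tb = Equivalence.from T-∧ (ta , tb)

T-∧⁻ : ∀ {a b} → T (a ∧ b) → T a × T b
T-∧⁻ = Equivalence.to T-∧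

<⇒≯ᵇ : ∀ {k x} → k < x → (x <ᵇ k) ≡ false
<⇒≯ᵇ {zero}  {suc x} _         = refl
<⇒≯ᵇ {suc k} {suc x} (s≤s k<x) = <⇒≯ᵇ k<x

_≺_ : List ℕ → List ℕ → Set
xs ≺ ys = All (λ x → All (x <_) ys) xs

takeWhileᵇ-++ : ∀ (p : ℕ → Bool) xs ys →
  takeWhileᵇ p (xs ++ ys) ≡ takeWhileᵇ p xs ++ (if all p xs then takeWhileᵇ p ys else [])
takeWhileᵇ-++ p []       ys = refl
takeWhileᵇ-++ p (x ∷ xs) ys with p x
... | true  = cong (x ∷_) (takeWhileᵇ-++ p xs ys)
... | false = refl

takeWhileᵇ-all : ∀ (p : ℕ → Bool) {ys} → All (T ∘ p) ys → takeWhileᵇ p ys ≡ ys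
takeWhileᵇ-all p []                   = refl
takeWhileᵇ-all p (_∷_ {y} py pys) with p y
... | true = cong (y ∷_) (takeWhileᵇ-all p pys)

evenᵇ-+-even : ∀ m {n} → T (evenᵇ n) → evenᵇ (m + n) ≡ evenᵇ m
evenᵇ-+-even zero    {n} even-n with evenᵇ n
... | true = refl
evenᵇ-+-even (suc m) even-n = cong not (evenᵇ-+-even m even-n)

|ρ|-parity-++ : ∀ x α {δ} → All (x <_) δ → T (evenᵇ (length δ)) →
  evenᵇ (length (ρ x (α ++ δ))) ≡ evenᵇ (length (ρ x α))
|ρ|-parity-++ x α {δ} x<δ even-δ rewrite takeWhileᵇ-++ (x <ᵇ_) α δ with all (x <ᵇ_) α
... | true  rewrite takeWhileᵇ-all (x <ᵇ_) (All.map <⇒<ᵇ x<δ) | length-++ (ρ x α) {δ} =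
  evenᵇ-+-even (length (ρ x α)) even-δ
... | false rewrite ++-identityʳ (ρ x α) = refl

jacobiᵇ-++ : ∀ α {δ} → α ≺ δ → T (evenᵇ (length δ)) → jacobiᵇ (α ++ δ) ≡ jacobiᵇ α ∧ jacobiᵇ δ
jacobiᵇ-++ []      α≺δ          even-δ = refl
jacobiᵇ-++ (x ∷ α) (x<δ ∷ α≺δ) even-δ
  rewrite |ρ|-parity-++ x α x<δ even-δ | jacobiᵇ-++ α α≺δ even-δ =
  sym (∧-assoc (evenᵇ (length (ρ x α))) (jacobiᵇ α) _)

ρ-∷ʳ-smaller : ∀ x γ {k} → k < x → ρ x (γ ∷ʳ k) ≡ ρ x γ
ρ-∷ʳ-smaller x []      k<x rewrite <⇒≯ᵇ k<x = refl
ρ-∷ʳ-smaller x (y ∷ γ) k<x with x <ᵇ y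
... | true  = cong (y ∷_) (ρ-∷ʳ-smaller x γ k<x)
... | false = refl

jacobiᵇ-∷ʳ-smaller : ∀ γ {k} → All (k <_) γ → jacobiᵇ (γ ∷ʳ k) ≡ jacobiᵇ γ
jacobiᵇ-∷ʳ-smaller []      []            = refl
jacobiᵇ-∷ʳ-smaller (y ∷ γ) (k<y ∷ k<γ) rewrite ρ-∷ʳ-smaller y γ k<y | jacobiᵇ-∷ʳ-smaller γ k<γ = refl

+-<ᵇ : ∀ c {x y} → (c + x <ᵇ c + y) ≡ (x <ᵇ y)
+-<ᵇ zero    = refl
+-<ᵇ (suc c) = +-<ᵇ c

ρ-shift : ∀ c x ys → ρ (c + x) (map (c +_) ys) ≡ map (c +_) (ρ x ys)
ρ-shift c x []       = refl
ρ-shift c x (y ∷ ys) rewrite +-<ᵇ c {x} {y} with x <ᵇ y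
... | true  = cong (c + y ∷_) (ρ-shift c x ys)
... | false = refl

jacobiᵇ-shift : ∀ c γ → jacobiᵇ (map (c +_) γ) ≡ jacobiᵇ γ
jacobiᵇ-shift c []      = refl
jacobiᵇ-shift c (x ∷ γ) rewrite ρ-shift c x γ | length-map (c +_) (ρ x γ) | jacobiᵇ-shift c γ = refl

jacobiᵇ-suffix : ∀ xs {ys} → T (jacobiᵇ (xs ++ ys)) → T (jacobiᵇ ys)
jacobiᵇ-suffix []       j = j
jacobiᵇ-suffix (x ∷ xs) j = jacobiᵇ-suffix xs (proj₂ (T-∧⁻ j))

jacobiᵇ-++-∷-below⇒even : ∀ α x {δ} → All (x <_) δ → T (jacobiᵇ (α ++ x ∷ δ)) → T (evenᵇ (length δ))
jacobiᵇ-++-∷-below⇒even α x x<δ j =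
  subst (T ∘ evenᵇ ∘ length) (takeWhileᵇ-all (x <ᵇ_) (All.map <⇒<ᵇ x<δ))
        (proj₁ (T-∧⁻ (jacobiᵇ-suffix α j)))

∨≡false : ∀ {a b} → a ∨ b ≡ false → a ≡ false × b ≡ false
∨≡false {false} {false} refl = refl , refl

any-++ : ∀ (p : ℕ → Bool) xs ys → any p (xs ++ ys) ≡ any p xs ∨ any p ys
any-++ p []       ys = refl
any-++ p (x ∷ xs) ys rewrite any-++ p xs ys = sym (∨-assoc (p x) (any p xs) (any p ys))

any-∷ʳ-false : ∀ (p : ℕ → Bool) xs {k} → p k ≡ false → any p (xs ∷ʳ k) ≡ any p xs
any-∷ʳ-false p xs {k} pk rewrite any-++ p xs (k ∷ []) | pk = ∨-identityʳ (any p xs)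

any≡false⁺ : ∀ (p : ℕ → Bool) {xs} → All (λ x → p x ≡ false) xs → any p xs ≡ false
any≡false⁺ p []         = refl
any≡false⁺ p (px ∷ pxs) rewrite px = any≡false⁺ p pxs

any≡false⁻ : ∀ (p : ℕ → Bool) xs → any p xs ≡ false → All (λ x → p x ≡ false) xs
any≡false⁻ p []       _ = []
any≡false⁻ p (x ∷ xs) h = let px , rest = ∨≡false {p x} h in px ∷ any≡false⁻ p xs rest

no-12-above : ∀ a b {ys} → All (a <_) ys → any (λ c → (b <ᵇ c) ∧ (c <ᵇ a)) ys ≡ false
no-12-above a b a<ys = any≡false⁺ _ (All.map (λ {c} a<c → trans (cong ((b <ᵇ c) ∧_) (<⇒≯ᵇ a<c)) (∧-zeroʳ (b <ᵇ c))) a<ys)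

has12belowᵇ-above : ∀ a {ys} → All (a <_) ys → has12belowᵇ a ys ≡ false
has12belowᵇ-above a []                       = refl
has12belowᵇ-above a (_∷_ {y} a<y a<ys)
  rewrite no-12-above a y a<ys | has12belowᵇ-above a a<ys = refl

has12belowᵇ-++-above : ∀ a xs {ys} → All (a <_) ys → has12belowᵇ a (xs ++ ys) ≡ has12belowᵇ a xs
has12belowᵇ-++-above a []       a<ys = has12belowᵇ-above a a<ys
has12belowᵇ-++-above a (b ∷ xs) {ys} a<ys
  rewrite any-++ (λ c → (b <ᵇ c) ∧ (c <ᵇ a)) xs ys | no-12-above a b a<ys
        | ∨-identityʳ (any (λ c → (b <ᵇ c) ∧ (c <ᵇ a)) xs) | has12belowᵇ-++-above a xs a<ys = refl

contains312ᵇ-++ : ∀ xs {ys} → xs ≺ ys → contains312ᵇ (xs ++ ys) ≡ contains312ᵇ xs ∨ contains312ᵇ ys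
contains312ᵇ-++ []       _               = refl
contains312ᵇ-++ (x ∷ xs) (x<ys ∷ xs≺ys)
  rewrite has12belowᵇ-++-above x xs x<ys | contains312ᵇ-++ xs xs≺ys =
  sym (∨-assoc (has12belowᵇ x xs) (contains312ᵇ xs) _)

has12belowᵇ-∷ʳ-smaller : ∀ a xs {k} → All (k <_) xs → has12belowᵇ a (xs ∷ʳ k) ≡ has12belowᵇ a xs
has12belowᵇ-∷ʳ-smaller a []       []            = refl
has12belowᵇ-∷ʳ-smaller a (b ∷ xs) {k} (k<b ∷ k<xs) =
  cong₂ _∨_ (any-∷ʳ-false (λ c → (b <ᵇ c) ∧ (c <ᵇ a)) xs (cong (_∧ (k <ᵇ a)) (<⇒≯ᵇ k<b)))
            (has12belowᵇ-∷ʳ-smaller a xs k<xs)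

contains312ᵇ-∷ʳ-smaller : ∀ xs {k} → All (k <_) xs → contains312ᵇ (xs ∷ʳ k) ≡ contains312ᵇ xs
contains312ᵇ-∷ʳ-smaller []       []            = refl
contains312ᵇ-∷ʳ-smaller (x ∷ xs) (k<x ∷ k<xs)
  rewrite has12belowᵇ-∷ʳ-smaller x xs k<xs | contains312ᵇ-∷ʳ-smaller xs k<xs = refl

any-12-shift : ∀ c a b xs →
  any (λ d → (c + b <ᵇ d) ∧ (d <ᵇ c + a)) (map (c +_) xs) ≡ any (λ d → (b <ᵇ d) ∧ (d <ᵇ a)) xs
any-12-shift c a b []       = refl
any-12-shift c a b (x ∷ xs) rewrite +-<ᵇ c {b} {x} | +-<ᵇ c {x} {a} | any-12-shift c a b xs = refl

has12belowᵇ-shift : ∀ c a xs → has12belowᵇ (c + a) (map (c +_) xs) ≡ has12belowᵇ a xs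
has12belowᵇ-shift c a []       = refl
has12belowᵇ-shift c a (b ∷ xs) rewrite any-12-shift c a b xs | has12belowᵇ-shift c a xs = refl

contains312ᵇ-shift : ∀ c xs → contains312ᵇ (map (c +_) xs) ≡ contains312ᵇ xs
contains312ᵇ-shift c []       = refl
contains312ᵇ-shift c (x ∷ xs) rewrite has12belowᵇ-shift c x xs | contains312ᵇ-shift c xs = refl

has12belowᵇ-∷ʳ≡false : ∀ a xs {k} → k < a → has12belowᵇ a (xs ∷ʳ k) ≡ false → All (k ≤_) xs
has12belowᵇ-∷ʳ≡false a []       k<a _ = []
has12belowᵇ-∷ʳ≡false a (b ∷ xs) {k} k<a h
  with no-12 , rest ← ∨≡false {any (λ c → (b <ᵇ c) ∧ (c <ᵇ a)) (xs ∷ʳ k)} h =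
  ≮⇒≥ b≮k ∷ has12belowᵇ-∷ʳ≡false a xs k<a rest
  where
  b≮k : ¬ b < k
  b≮k b<k = subst T (All.head (AllP.++⁻ʳ xs (any≡false⁻ _ (xs ∷ʳ k) no-12))) (T-∧⁺ (<⇒<ᵇ b<k) (<⇒<ᵇ k<a))

-- A letter above k followed by one below k would form a 312 with the final k.
avoids312-split-at-last : ∀ init {k} → All (_≢ k) init → contains312ᵇ (init ∷ʳ k) ≡ false →
  ∃₂ λ α β → init ≡ α ++ β × All (_< k) α × All (k <_) β
avoids312-split-at-last []       _                  _ = [] , [] , refl , [] , []
avoids312-split-at-last (x ∷ xs) {k} (x≢k ∷ xs≢k) avoids
  with ∨≡false {has12belowᵇ x (xs ∷ʳ k)} avoids | x <? k
... | _ , avoids-xs | yes x<k =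
  let α , β , xs≡α++β , α<k , k<β = avoids312-split-at-last xs xs≢k avoids-xs
  in x ∷ α , β , cong (x ∷_) xs≡α++β , x<k ∷ α<k , k<β
... | no-12 , _ | no x≮k =
  [] , x ∷ xs , refl , [] , k<x ∷ All.zipWith (λ (k≤y , y≢k) → ≤∧≢⇒< k≤y (y≢k ∘ sym))
                                              (has12belowᵇ-∷ʳ≡false x xs k<x no-12 , xs≢k)
  where
  k<x : k < x
  k<x = ≤∧≢⇒< (≮⇒≥ x≮k) (x≢k ∘ sym)

-- Permutations and their decomposition at the last letter

InRange : ℕ → ℕ → Set
InRange m x = 1 ≤ x × x ≤ m

record IsPerm (m : ℕ) (π : List ℕ) : Set where
  constructor isPerm
  field
    length≡ : length π ≡ m
    unique  : Unique π
    inRange : All (InRange m) π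

record IsJacobi312 (m : ℕ) (π : List ℕ) : Set where
  constructor isJacobi312
  field
    perm   : IsPerm m π
    jacobi : T (jacobiᵇ π)
    avoids : contains312ᵇ π ≡ false

T-not-any-≡ᵇ⇒ : ∀ x ys → T (not (any (x ≡ᵇ_) ys)) → All (x ≢_) ys
T-not-any-≡ᵇ⇒ x []       _ = []
T-not-any-≡ᵇ⇒ x (y ∷ ys) t with x ≡ᵇ y in x≡ᵇy
... | false = (λ x≡y → subst T x≡ᵇy (≡⇒≡ᵇ x y x≡y)) ∷ T-not-any-≡ᵇ⇒ x ys t

T-not-any-≡ᵇ⇐ : ∀ x {ys} → All (x ≢_) ys → T (not (any (x ≡ᵇ_) ys))
T-not-any-≡ᵇ⇐ x []                     = tt
T-not-any-≡ᵇ⇐ x (_∷_ {y} x≢y x≢ys) with x ≡ᵇ y in x≡ᵇy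
... | true  = x≢y (≡ᵇ⇒≡ x y (subst T (sym x≡ᵇy) tt))
... | false = T-not-any-≡ᵇ⇐ x x≢ys

distinctᵇ⇔Unique : ∀ xs → T (distinctᵇ xs) ⇔ Unique xs
distinctᵇ⇔Unique []       = mk⇔ (λ _ → []) (λ _ → tt)
distinctᵇ⇔Unique (x ∷ xs) = mk⇔
  (λ t → let fresh , rest = T-∧⁻ t in T-not-any-≡ᵇ⇒ x xs fresh ∷ Equivalence.to (distinctᵇ⇔Unique xs) rest)
  (λ { (x∉xs ∷ u) → T-∧⁺ (T-not-any-≡ᵇ⇐ x x∉xs) (Equivalence.from (distinctᵇ⇔Unique xs) u) })

inRangeᵇ⇔ : ∀ m x → T ((1 ≤ᵇ x) ∧ (x ≤ᵇ m)) ⇔ InRange m x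
inRangeᵇ⇔ m x = mk⇔ (λ t → let l , u = T-∧⁻ t in ≤ᵇ⇒≤ 1 x l , ≤ᵇ⇒≤ x m u)
                    (λ (l , u) → T-∧⁺ (≤⇒≤ᵇ l) (≤⇒≤ᵇ u))

isPermᵇ⇔IsPerm : ∀ m π → T (isPermᵇ m π) ⇔ IsPerm m π
isPermᵇ⇔IsPerm m π = mk⇔
  (λ t → let len , t′ = T-∧⁻ t ; dist , rng = T-∧⁻ t′ in
     isPerm (≡ᵇ⇒≡ (length π) m len) (Equivalence.to (distinctᵇ⇔Unique π) dist)
            (All.map (Equivalence.to (inRangeᵇ⇔ m _)) (AllP.all⁺ _ π rng)))
  (λ (isPerm len u rng) → T-∧⁺ (≡⇒≡ᵇ (length π) m len) (T-∧⁺ (Equivalence.from (distinctᵇ⇔Unique π) u)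
                                (AllP.all⁻ _ (All.map (Equivalence.from (inRangeᵇ⇔ m _)) rng))))

lastIsᵇ⇔ : ∀ k π → T (lastIsᵇ k π) ⇔ ∃ λ init → π ≡ init ∷ʳ k
lastIsᵇ⇔ k π = mk⇔ (to π) (λ (init , π≡) → subst (T ∘ lastIsᵇ k) (sym π≡) (from init))
  where
  to : ∀ π → T (lastIsᵇ k π) → ∃ λ init → π ≡ init ∷ʳ k
  to π t with initLast π
  ... | init ∷ʳ′ x with last (init ∷ʳ x) | last-∷ʳ init x
  ...   | just .x | refl = init , cong (init ∷ʳ_) (≡ᵇ⇒≡ x k t)
  from : ∀ init → T (lastIsᵇ k (init ∷ʳ k))
  from init with last (init ∷ʳ k) | last-∷ʳ init k
  ... | just .k | refl = ≡⇒≡ᵇ k k refl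

JLast⇔ : ∀ m k π → JLast m k π ⇔ (IsJacobi312 m π × ∃ λ init → π ≡ init ∷ʳ k)
JLast⇔ m k π = mk⇔
  (λ t → let perm , t₁ = T-∧⁻ t ; jac , t₂ = T-∧⁻ t₁ ; av , lst = T-∧⁻ t₂ in
     isJacobi312 (Equivalence.to (isPermᵇ⇔IsPerm m π) perm) jac (Equivalence.to T-not-≡ av) ,
     Equivalence.to (lastIsᵇ⇔ k π) lst)
  (λ (isJacobi312 perm jac av , lst) →
     T-∧⁺ (Equivalence.from (isPermᵇ⇔IsPerm m π) perm)
          (T-∧⁺ jac (T-∧⁺ (Equivalence.from T-not-≡ av) (Equivalence.from (lastIsᵇ⇔ k π) lst))))

length≤1+|filter≤| : ∀ n {xs} → Unique xs → All (_≤ suc n) xs → length xs ≤ suc (length (filter (_≤? n) xs))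
length≤1+|filter≤| n []                 _                 = z≤n
length≤1+|filter≤| n {x ∷ xs} (x∉xs ∷ u) (x≤1+n ∷ xs≤1+n) with x ≤? n
... | yes x≤n = subst (λ ys → suc (length xs) ≤ suc (length ys)) (sym (filter-accept (_≤? n) x≤n))
                    (s≤s (length≤1+|filter≤| n u xs≤1+n))
... | no x≰n  = s≤s (≤-reflexive (cong length (sym (trans (filter-reject (_≤? n) x≰n) (filter-all (_≤? n) xs≤n)))))
  where
  xs≤n : All (_≤ n) xs
  xs≤n = All.zipWith (λ (y≤1+n , x≢y) → ≤-pred (≤∧≢⇒< y≤1+n (λ y≡1+n → x≢y (trans (≤-antisym x≤1+n (≰⇒> x≰n)) (sym y≡1+n)))))
                     (xs≤1+n , x∉xs)

Unique-InRange⇒length≤ : ∀ n {xs} → Unique xs → All (InRange n) xs → length xs ≤ n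
Unique-InRange⇒length≤ zero    {[]}    _ _                = z≤n
Unique-InRange⇒length≤ zero    {x ∷ _} _ ((1≤x , x≤0) ∷ _) = contradiction (≤-trans 1≤x x≤0) λ ()
Unique-InRange⇒length≤ (suc n) {xs}    u inRange = ≤-trans (length≤1+|filter≤| n u (All.map proj₂ inRange))
  (s≤s (Unique-InRange⇒length≤ n (UP.filter⁺ (_≤? n) u)
         (All.zipWith (λ ((1≤x , _) , x≤n) → 1≤x , x≤n) (AllP.filter⁺ (_≤? n) inRange , AllP.all-filter (_≤? n) xs))))

upperBlock : ℕ → List ℕ → List ℕ
upperBlock k γ = map (k +_) γ ∷ʳ k

glue : ℕ → List ℕ → List ℕ → List ℕ
glue k α γ = α ++ upperBlock k γ

glue-∷ʳ : ∀ k α γ → glue k α γ ≡ (α ++ map (k +_) γ) ∷ʳ k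
glue-∷ʳ k α γ = sym (++-assoc α (map (k +_) γ) (k ∷ []))

length-upperBlock : ∀ k γ → length (upperBlock k γ) ≡ suc (length γ)
length-upperBlock k γ = trans (length-++ (map (k +_) γ)) (trans (cong (_+ 1) (length-map (k +_) γ)) (+-comm (length γ) 1))

length-glue : ∀ k α γ → length (glue k α γ) ≡ length α + (length γ + 1)
length-glue k α γ = trans (length-++ α) (cong (length α +_) (trans (length-upperBlock k γ) (+-comm 1 (length γ))))

shift-above : ∀ k {γ} → All (1 ≤_) γ → All (k <_) (map (k +_) γ)
shift-above k 1≤γ = AllP.map⁺ (All.map (m<m+n k) 1≤γ)

IsPerm-glue : ∀ {a b α γ} → IsPerm a α → IsPerm b γ → IsPerm (suc (a + b)) (glue (suc a) α γ)
IsPerm-glue {a} {b} {α} {γ} (isPerm len-α u-α rng-α) (isPerm len-γ u-γ rng-γ) = isPerm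
  (trans (length-glue (suc a) α γ) (trans (cong₂ (λ x y → x + (y + 1)) len-α len-γ) (trans (cong (a +_) (+-comm b 1)) (+-suc a b))))
  (UP.++⁺ u-α (UP.++⁺ (UP.map⁺ (+-cancelˡ-≡ (suc a) _ _) u-γ) ([] ∷ []) k∉shifted) α∩δ≡∅)
  (AllP.++⁺ (All.map (λ (1≤x , x≤a) → 1≤x , ≤-trans x≤a (≤-trans (m≤m+n a b) (n≤1+n _))) rng-α)
            (All.map (λ (k≤y , y≤m) → ≤-trans (s≤s z≤n) k≤y , y≤m) δ-bounds))
  where
  shifted-bounds : All (λ y → suc a < y × y ≤ suc (a + b)) (map (suc a +_) γ)
  shifted-bounds = AllP.map⁺ (All.map (λ (1≤y , y≤b) → m<m+n (suc a) 1≤y , +-monoʳ-≤ (suc a) y≤b) rng-γ)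
  δ-bounds : All (λ y → suc a ≤ y × y ≤ suc (a + b)) (map (suc a +_) γ ∷ʳ suc a)
  δ-bounds = AllP.++⁺ (All.map (λ (k<y , y≤m) → <⇒≤ k<y , y≤m) shifted-bounds) ((≤-refl , s≤s (m≤m+n a b)) ∷ [])
  k∉shifted : ∀ {v} → ¬ (v ∈ map (suc a +_) γ × v ∈ suc a ∷ [])
  k∉shifted (v∈shifted , here refl) = <-irrefl refl (proj₁ (All.lookup shifted-bounds v∈shifted))
  α∩δ≡∅ : ∀ {v} → ¬ (v ∈ α × v ∈ map (suc a +_) γ ∷ʳ suc a)
  α∩δ≡∅ (v∈α , v∈δ) = <⇒≱ (s≤s (proj₂ (All.lookup rng-α v∈α))) (proj₁ (All.lookup δ-bounds v∈δ))

unglue-blocks : ∀ {m a α γ} → IsPerm m (glue (suc a) α γ) → All (_< suc a) α →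
  (Unique α × All (InRange a) α) × (Unique γ × All (InRange (m ∸ suc a)) γ) × suc a ≤ m
unglue-blocks {m} {a} {α} {γ} (isPerm _ u rng) α<k = (u-α , rng-α) , (u-γ , rng-γ) , k≤m
  where
  k = suc a
  u-α = proj₁ (Unique-++⁻ α u)
  u-δ = proj₂ (Unique-++⁻ α u)
  u-γ = UP.map⁻ (proj₁ (Unique-++⁻ (map (k +_) γ) u-δ))
  rng-δ = AllP.++⁻ʳ α rng
  k≤m = proj₂ (All.head (AllP.++⁻ʳ (map (k +_) γ) rng-δ))
  rng-α = All.zipWith (λ ((1≤x , _) , x<k) → 1≤x , ≤-pred x<k) (AllP.++⁻ˡ α rng , α<k)
  rng-γ = All.zipWith
    (λ {y} ((_ , k+y≤m) , k+y≢k) → n≢0⇒n>0 (λ y≡0 → k+y≢k (trans (cong (k +_) y≡0) (+-identityʳ k))) ,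
                                  m+n≤o⇒m≤o∸n y (subst (_≤ m) (+-comm k y) k+y≤m))
    (AllP.map⁻ (AllP.++⁻ˡ (map (k +_) γ) rng-δ) , AllP.map⁻ (Unique-∷ʳ⁻ (map (k +_) γ) u-δ))

-- Pigeonhole: |α| ≤ a and |γ| ≤ m − (a + 1), while |α| + |γ| = m − 1.
IsPerm-unglue : ∀ {m a α γ} → IsPerm m (glue (suc a) α γ) → All (_< suc a) α →
  ∃ λ b → m ≡ suc (a + b) × IsPerm a α × IsPerm b γ
IsPerm-unglue {m} {a} {α} {γ} p α<k
  with (u-α , rng-α) , (u-γ , rng-γ) , k≤m ← unglue-blocks p α<k =
  length γ , m≡1+a+b , isPerm |α|≡a u-α rng-α ,
  isPerm refl u-γ (subst (λ n → All (InRange n) γ) (trans (cong (_∸ suc a) m≡1+a+b) (m+n∸m≡n a (length γ))) rng-γ)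
  where
  m≡|α|+|γ|+1 : m ≡ length α + (length γ + 1)
  m≡|α|+|γ|+1 = trans (sym (IsPerm.length≡ p)) (length-glue (suc a) α γ)
  cancel : ∀ A B → B + suc a ≤ A + (B + 1) → a ≤ A
  cancel A B le = +-cancelˡ-≤ (B + 1) a A (subst₂ _≤_ (sym (+-assoc B 1 a)) (+-comm A (B + 1)) le)
  |α|≡a : length α ≡ a
  |α|≡a = ≤-antisym (Unique-InRange⇒length≤ a u-α rng-α) (cancel (length α) (length γ)
    (subst (length γ + suc a ≤_) m≡|α|+|γ|+1 (m≤o∸n⇒m+n≤o (length γ) k≤m (Unique-InRange⇒length≤ (m ∸ suc a) u-γ rng-γ))))
  m≡1+a+b : m ≡ suc (a + length γ)
  m≡1+a+b = trans m≡|α|+|γ|+1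
    (trans (cong (_+ (length γ + 1)) |α|≡a) (trans (cong (a +_) (+-comm (length γ) 1)) (+-suc a (length γ))))

below≺upperBlock : ∀ {k α} γ → All (_< k) α → All (1 ≤_) γ → α ≺ upperBlock k γ
below≺upperBlock γ α<k 1≤γ =
  All.map (λ x<k → AllP.++⁺ (All.map (<-trans x<k) (shift-above _ 1≤γ)) (x<k ∷ [])) α<k

jacobiᵇ-upperBlock : ∀ k {γ} → All (1 ≤_) γ → jacobiᵇ (upperBlock k γ) ≡ jacobiᵇ γ
jacobiᵇ-upperBlock k {γ} 1≤γ = trans (jacobiᵇ-∷ʳ-smaller (map (k +_) γ) (shift-above k 1≤γ)) (jacobiᵇ-shift k γ)

contains312ᵇ-upperBlock : ∀ k {γ} → All (1 ≤_) γ → contains312ᵇ (upperBlock k γ) ≡ contains312ᵇ γ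
contains312ᵇ-upperBlock k {γ} 1≤γ =
  trans (contains312ᵇ-∷ʳ-smaller (map (k +_) γ) (shift-above k 1≤γ)) (contains312ᵇ-shift k γ)

contains312ᵇ-glue : ∀ {k} α {γ} → All (_< k) α → All (1 ≤_) γ →
  contains312ᵇ (glue k α γ) ≡ contains312ᵇ α ∨ contains312ᵇ γ
contains312ᵇ-glue {k} α {γ} α<k 1≤γ =
  trans (contains312ᵇ-++ α (below≺upperBlock γ α<k 1≤γ)) (cong (contains312ᵇ α ∨_) (contains312ᵇ-upperBlock k 1≤γ))

-- For glue (suc a) α γ with |α| = a, |γ| = b: a nonempty α ends in a letter that sees all b + 1
-- letters of the upper block, so b must be odd.
admissibleᵇ : ℕ → ℕ → Bool
admissibleᵇ a b = (a ≡ᵇ 0) ∨ evenᵇ (suc b)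

jacobiᵇ-++⇒even : ∀ α {δ} → α ≺ δ → α ≢ [] → T (jacobiᵇ (α ++ δ)) → T (evenᵇ (length δ))
jacobiᵇ-++⇒even α {δ} α≺δ α≢[] j with initLast α
... | []       = contradiction refl α≢[]
... | α₀ ∷ʳ′ x = jacobiᵇ-++-∷-below⇒even α₀ x (All.head (AllP.++⁻ʳ α₀ α≺δ)) (subst (T ∘ jacobiᵇ) (∷ʳ-++ α₀ x δ) j)

jacobiᵇ-glue : ∀ {k} α γ → All (_< k) α → All (1 ≤_) γ →
  T (jacobiᵇ (glue k α γ)) ⇔ (T (jacobiᵇ α) × T (jacobiᵇ γ) × T (admissibleᵇ (length α) (length γ)))
jacobiᵇ-glue {k} [] γ _ 1≤γ = mk⇔
  (λ j → tt , subst T (jacobiᵇ-upperBlock k 1≤γ) j , tt)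
  (λ (_ , jγ , _) → subst T (sym (jacobiᵇ-upperBlock k 1≤γ)) jγ)
jacobiᵇ-glue {k} α@(_ ∷ _) γ α<k 1≤γ = mk⇔
  (λ j → let even = jacobiᵇ-++⇒even α α≺δ (λ ()) j
             jα , jδ = T-∧⁻ (subst T (jacobiᵇ-++ α α≺δ even) j)
         in jα , subst T (jacobiᵇ-upperBlock k 1≤γ) jδ , subst (T ∘ evenᵇ) (length-upperBlock k γ) even)
  (λ (jα , jγ , even) → subst T (sym (jacobiᵇ-++ α α≺δ (subst (T ∘ evenᵇ) (sym (length-upperBlock k γ)) even)))
                              (T-∧⁺ jα (subst T (sym (jacobiᵇ-upperBlock k 1≤γ)) jγ)))
  where
  α≺δ = below≺upperBlock γ α<k 1≤γ

glue-isJacobi312 : ∀ {a b α γ} → IsJacobi312 a α → IsJacobi312 b γ → T (admissibleᵇ a b) →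
  IsJacobi312 (suc (a + b)) (glue (suc a) α γ)
glue-isJacobi312 {α = α} {γ} (isJacobi312 pα jα avα) (isJacobi312 pγ jγ avγ) adm = isJacobi312
  (IsPerm-glue pα pγ)
  (Equivalence.from (jacobiᵇ-glue α γ α<k 1≤γ)
     (jα , jγ , subst₂ (λ a b → T (admissibleᵇ a b)) (sym (IsPerm.length≡ pα)) (sym (IsPerm.length≡ pγ)) adm))
  (trans (contains312ᵇ-glue α α<k 1≤γ) (cong₂ _∨_ avα avγ))
  where
  α<k = All.map (s≤s ∘ proj₂) (IsPerm.inRange pα)
  1≤γ = All.map proj₁ (IsPerm.inRange pγ)

record Decomposition (m k : ℕ) (π : List ℕ) : Set where
  constructor decomposition
  field
    {a b}      : ℕ
    {α γ}      : List ℕ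
    m≡1+a+b    : m ≡ suc (a + b)
    k≡1+a      : k ≡ suc a
    admissible : T (admissibleᵇ a b)
    α-isJ      : IsJacobi312 a α
    γ-isJ      : IsJacobi312 b γ
    π≡glue     : π ≡ glue (suc a) α γ

map-+-∸ : ∀ k {β} → All (k ≤_) β → map (k +_) (map (_∸ k) β) ≡ β
map-+-∸ k []           = refl
map-+-∸ k (k≤y ∷ k≤β) = cong₂ _∷_ (m+[n∸m]≡n k≤y) (map-+-∸ k k≤β)

split-at-last : ∀ {m a} init → IsJacobi312 m (init ∷ʳ suc a) →
  ∃₂ λ α γ → All (_< suc a) α × init ∷ʳ suc a ≡ glue (suc a) α γ
split-at-last {a = a} init (isJacobi312 p _ av)
  with α , β , init≡α++β , α<k , k<β ← avoids312-split-at-last init (Unique-∷ʳ⁻ init (IsPerm.unique p)) av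
  = α , map (_∸ suc a) β , α<k ,
    trans (cong (_∷ʳ suc a) (trans init≡α++β (cong (α ++_) (sym (map-+-∸ (suc a) (All.map <⇒≤ k<β))))))
          (sym (glue-∷ʳ (suc a) α (map (_∸ suc a) β)))

decompose-glue : ∀ {m a α γ} → IsJacobi312 m (glue (suc a) α γ) → All (_< suc a) α →
  Decomposition m (suc a) (glue (suc a) α γ)
decompose-glue {α = α} {γ} (isJacobi312 p jac av) α<k
  with b , m≡1+a+b , pα , pγ ← IsPerm-unglue p α<k
  with jα , jγ , adm ← Equivalence.to (jacobiᵇ-glue α γ α<k (All.map proj₁ (IsPerm.inRange pγ))) jac
     | avα , avγ ← ∨≡false (trans (sym (contains312ᵇ-glue α α<k (All.map proj₁ (IsPerm.inRange pγ)))) av)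
  = decomposition m≡1+a+b refl (subst₂ (λ x y → T (admissibleᵇ x y)) (IsPerm.length≡ pα) (IsPerm.length≡ pγ) adm)
      (isJacobi312 pα jα avα) (isJacobi312 pγ jγ avγ) refl

decompose : ∀ {m k} init → IsJacobi312 m (init ∷ʳ k) → Decomposition m k (init ∷ʳ k)
decompose {k = zero} init isJ =
  contradiction (proj₁ (All.head (AllP.++⁻ʳ init (IsPerm.inRange (IsJacobi312.perm isJ))))) λ ()
decompose {m} {suc a} init isJ with α , γ , α<k , π≡glue ← split-at-last init isJ =
  subst (Decomposition m (suc a)) (sym π≡glue) (decompose-glue (subst (IsJacobi312 m) π≡glue isJ) α<k)

glue-injective : ∀ k α α′ {γ γ′} → length α ≡ length α′ → glue k α γ ≡ glue k α′ γ′ → α ≡ α′ × γ ≡ γ′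
glue-injective k α α′ {γ} {γ′} len eq with ++-cancel-length α α′ len eq
... | α≡α′ , δ≡δ′ = α≡α′ , map-injective (+-cancelˡ-≡ k _ _) (proj₁ (∷ʳ-injective (map (k +_) γ) (map (k +_) γ′) δ≡δ′))

-- Enumeration and counting

evenᵇ-double : ∀ n → evenᵇ (n + n) ≡ true
evenᵇ-double zero    = refl
evenᵇ-double (suc n) rewrite +-suc n n | evenᵇ-double n = refl

⌊1+n+n/2⌋≡n : ∀ n → ⌊ suc (n + n) /2⌋ ≡ n
⌊1+n+n/2⌋≡n zero    = refl
⌊1+n+n/2⌋≡n (suc n) rewrite +-suc n n = cong suc (⌊1+n+n/2⌋≡n n)

jacobi312Count : ℕ → ℕ
jacobi312Count m = fussCatalan (if evenᵇ m then 1 else 2) ⌊ m /2⌋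

jacobi312Count-even : ∀ n → jacobi312Count (n + n) ≡ fussCatalan 1 n
jacobi312Count-even n rewrite evenᵇ-double n = cong (fussCatalan 1) (sym (n≡⌊n+n/2⌋ n))

jacobi312Count-odd : ∀ n → jacobi312Count (suc (n + n)) ≡ fussCatalan 2 n
jacobi312Count-odd n rewrite evenᵇ-double n = cong (fussCatalan 2) (⌊1+n+n/2⌋≡n n)

jacobi312LastCount : ℕ → ℕ → ℕ
jacobi312LastCount a b = if admissibleᵇ a b then jacobi312Count a * jacobi312Count b else 0

jacobi312LastCount-odd : ∀ a j → jacobi312LastCount a (suc (j + j)) ≡ jacobi312Count a * jacobi312Count (suc (j + j))
jacobi312LastCount-odd a j rewrite evenᵇ-double j | ∨-zeroʳ (a ≡ᵇ 0) = refl

jacobi312LastCount-even : ∀ a j → jacobi312LastCount (suc a) (j + j) ≡ 0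
jacobi312LastCount-even a j rewrite evenᵇ-double j = refl

jacobi312LastCount-pair : ∀ a j →
  jacobi312LastCount a (suc (j + j)) + jacobi312LastCount (suc a) (j + j) ≡ jacobi312Count a * jacobi312Count (suc (j + j))
jacobi312LastCount-pair a j =
  trans (cong₂ _+_ (jacobi312LastCount-odd a j) (jacobi312LastCount-even a j)) (+-identityʳ _)

parity : ∀ m → (∃ λ n → m ≡ n + n) ⊎ (∃ λ n → m ≡ suc (n + n))
parity zero    = inj₁ (0 , refl)
parity (suc m) with parity m
... | inj₁ (n , m≡n+n)   = inj₂ (n , cong suc m≡n+n)
... | inj₂ (n , m≡1+n+n) = inj₁ (suc n , trans (cong suc m≡1+n+n) (sym (+-suc (suc n) n)))

jacobi312Count-suc : ∀ m → antidiagonalSum m jacobi312LastCount ≡ jacobi312Count (suc m)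
jacobi312Count-suc m with parity m
... | inj₂ (n , refl) = begin
  antidiagonalSum (suc (n + n)) L
    ≡⟨ antidiagonalSum-odd n L ⟩
  antidiagonalSum n (λ i j → L (i + i) (suc (j + j)) + L (suc (i + i)) (j + j))
    ≡⟨ antidiagonalSum-cong n (λ i j _ → trans (jacobi312LastCount-pair (i + i) j)
                                               (cong₂ _*_ (jacobi312Count-even i) (jacobi312Count-odd j))) ⟩
  antidiagonalSum n (λ i j → fussCatalan 1 i * fussCatalan 2 j)
    ≡⟨ fussCatalan-convolution 1 2 n ⟩
  fussCatalan 1 (suc n)
    ≡⟨ jacobi312Count-even (suc n) ⟨
  jacobi312Count (suc n + suc n)
    ≡⟨ cong jacobi312Count (+-suc (suc n) n) ⟩
  jacobi312Count (suc (suc (n + n))) ∎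
  where L = jacobi312LastCount
... | inj₁ (zero , refl) = refl
... | inj₁ (suc n , refl) = begin
  antidiagonalSum (suc n + suc n) L
    ≡⟨ antidiagonalSum-even n L ⟩
  L 0 (suc n + suc n) + antidiagonalSum n (λ i j → L (suc (i + i)) (suc (j + j)) + L (suc (suc (i + i))) (j + j))
    ≡⟨ cong₂ _+_ (trans (+-identityʳ _) (jacobi312Count-even (suc n)))
                 (antidiagonalSum-cong n (λ i j _ → trans (jacobi312LastCount-pair (suc (i + i)) j)
                                                          (cong₂ _*_ (jacobi312Count-odd i) (jacobi312Count-odd j)))) ⟩
  fussCatalan 1 (suc n) + antidiagonalSum n (λ i j → fussCatalan 2 i * fussCatalan 2 j)
    ≡⟨ cong (fussCatalan 1 (suc n) +_) (fussCatalan-convolution 2 2 n) ⟩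
  fussCatalan 2 (suc n)
    ≡⟨ jacobi312Count-odd (suc n) ⟨
  jacobi312Count (suc (suc n + suc n)) ∎
  where L = jacobi312LastCount

summands≤ : ∀ {a b m f} → a + b ≡ m → m ≤ f → a ≤ f × b ≤ f
summands≤ {a} {b} refl m≤f = ≤-trans (m≤m+n a b) m≤f , ≤-trans (m≤n+m b a) m≤f

-- The fuel only makes the recursion structural; jacobi312Perms f m is complete once m ≤ f.
mutual
  jacobi312Perms : ℕ → ℕ → List (List ℕ)
  jacobi312Perms _          zero    = [] ∷ []
  jacobi312Perms zero       (suc m) = []
  jacobi312Perms (suc fuel) (suc m) = antidiagonalConcat m (jacobi312PermsEndingIn fuel)

  jacobi312PermsEndingIn : ℕ → ℕ → ℕ → List (List ℕ)
  jacobi312PermsEndingIn fuel a b =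
    if admissibleᵇ a b then cartesianProductWith (glue (suc a)) (jacobi312Perms fuel a) (jacobi312Perms fuel b) else []

mutual
  ∈-jacobi312Perms⁻ : ∀ f m {π} → π ∈ jacobi312Perms f m → IsJacobi312 m π
  ∈-jacobi312Perms⁻ f       zero    (here refl) = isJacobi312 (isPerm refl [] []) tt refl
  ∈-jacobi312Perms⁻ (suc f) (suc m) π∈ with ∈-antidiagonalConcat⁻ m (jacobi312PermsEndingIn f) π∈
  ... | a , b , refl , π∈′ = proj₁ (∈-jacobi312PermsEndingIn⁻ f a b π∈′)

  ∈-jacobi312PermsEndingIn⁻ : ∀ f a b {π} → π ∈ jacobi312PermsEndingIn f a b →
    IsJacobi312 (suc (a + b)) π × ∃ λ init → π ≡ init ∷ʳ suc a
  ∈-jacobi312PermsEndingIn⁻ f a b π∈ with admissibleᵇ a b in adm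
  ... | true with ∈-cartesianProductWith⁻ (glue (suc a)) (jacobi312Perms f a) (jacobi312Perms f b) π∈
  ...   | α , γ , α∈ , γ∈ , refl =
    glue-isJacobi312 (∈-jacobi312Perms⁻ f a α∈) (∈-jacobi312Perms⁻ f b γ∈) (subst T (sym adm) tt) ,
    α ++ map (suc a +_) γ , glue-∷ʳ (suc a) α γ

mutual
  ∈-jacobi312Perms⁺ : ∀ f m {π} → m ≤ f → IsJacobi312 m π → π ∈ jacobi312Perms f m
  ∈-jacobi312Perms⁺ f       zero    {[]}    _ _                                   = here refl
  ∈-jacobi312Perms⁺ f       zero    {_ ∷ _} _ (isJacobi312 (isPerm () _ _) _ _)
  ∈-jacobi312Perms⁺ (suc f) (suc m) {π} (s≤s m≤f) isJ with initLast π | IsPerm.length≡ (IsJacobi312.perm isJ)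
  ... | []         | ()
  ... | init ∷ʳ′ k | _ with decompose init isJ
  ...   | decomposition {a} {b} m≡1+a+b refl adm αJ γJ π≡glue =
    let a≤f , b≤f = summands≤ (suc-injective (sym m≡1+a+b)) m≤f in
    ∈-antidiagonalConcat⁺ m (jacobi312PermsEndingIn f) a b (suc-injective (sym m≡1+a+b))
      (subst (_∈ jacobi312PermsEndingIn f a b) (sym π≡glue) (∈-jacobi312PermsEndingIn⁺ f a b a≤f b≤f αJ γJ adm))

  ∈-jacobi312PermsEndingIn⁺ : ∀ f a b {α γ} → a ≤ f → b ≤ f → IsJacobi312 a α → IsJacobi312 b γ →
    T (admissibleᵇ a b) → glue (suc a) α γ ∈ jacobi312PermsEndingIn f a b
  ∈-jacobi312PermsEndingIn⁺ f a b a≤f b≤f αJ γJ adm with admissibleᵇ a b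
  ... | true = ∈-cartesianProductWith⁺ (glue (suc a)) (∈-jacobi312Perms⁺ f a a≤f αJ) (∈-jacobi312Perms⁺ f b b≤f γJ)

mutual
  Unique-jacobi312Perms : ∀ f m → Unique (jacobi312Perms f m)
  Unique-jacobi312Perms f       zero    = [] ∷ []
  Unique-jacobi312Perms zero    (suc m) = []
  Unique-jacobi312Perms (suc f) (suc m) =
    Unique-antidiagonalConcat m (jacobi312PermsEndingIn f) (Unique-jacobi312PermsEndingIn f) same-last-letter
    where
    same-last-letter : ∀ a b a′ b′ {π} → π ∈ jacobi312PermsEndingIn f a b → π ∈ jacobi312PermsEndingIn f a′ b′ → a ≡ a′
    same-last-letter a b a′ b′ π∈ π∈′ with ∈-jacobi312PermsEndingIn⁻ f a b π∈ | ∈-jacobi312PermsEndingIn⁻ f a′ b′ π∈′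
    ... | _ , init , refl | _ , init′ , π≡ = suc-injective (proj₂ (∷ʳ-injective init init′ π≡))

  Unique-jacobi312PermsEndingIn : ∀ f a b → Unique (jacobi312PermsEndingIn f a b)
  Unique-jacobi312PermsEndingIn f a b with admissibleᵇ a b
  ... | false = []
  ... | true  = Unique-cartesianProductWith (glue (suc a))
    (λ {α} {α′} α∈ α′∈ _ _ → glue-injective (suc a) α α′ (trans (length≡a α∈) (sym (length≡a α′∈))))
    (Unique-jacobi312Perms f a) (Unique-jacobi312Perms f b)
    where
    length≡a : ∀ {α} → α ∈ jacobi312Perms f a → length α ≡ a
    length≡a α∈ = IsPerm.length≡ (IsJacobi312.perm (∈-jacobi312Perms⁻ f a α∈))

mutual
  length-jacobi312Perms : ∀ f m → m ≤ f → length (jacobi312Perms f m) ≡ jacobi312Count m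
  length-jacobi312Perms f       zero    _         = refl
  length-jacobi312Perms (suc f) (suc m) (s≤s m≤f) = begin
    length (antidiagonalConcat m (jacobi312PermsEndingIn f))
      ≡⟨ length-antidiagonalConcat m (jacobi312PermsEndingIn f) ⟩
    antidiagonalSum m (λ a b → length (jacobi312PermsEndingIn f a b))
      ≡⟨ antidiagonalSum-cong m (λ a b a+b≡m → let a≤f , b≤f = summands≤ a+b≡m m≤f in
                                                length-jacobi312PermsEndingIn f a b a≤f b≤f) ⟩
    antidiagonalSum m jacobi312LastCount
      ≡⟨ jacobi312Count-suc m ⟩
    jacobi312Count (suc m) ∎

  length-jacobi312PermsEndingIn : ∀ f a b → a ≤ f → b ≤ f → length (jacobi312PermsEndingIn f a b) ≡ jacobi312LastCount a b
  length-jacobi312PermsEndingIn f a b a≤f b≤f with admissibleᵇ a b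
  ... | false = refl
  ... | true  = trans (length-cartesianProductWith (glue (suc a)) (jacobi312Perms f a) (jacobi312Perms f b))
                      (cong₂ _*_ (length-jacobi312Perms f a a≤f) (length-jacobi312Perms f b b≤f))

jlast-count : ∀ a b → jlast≡ (suc (a + b)) (suc a) (jacobi312LastCount a b)
jlast-count a b = subst (λ N → Fin N ↔ Σ (List ℕ) (JLast (suc (a + b)) (suc a)))
  (length-jacobi312PermsEndingIn (a + b) a b (m≤m+n a b) (m≤n+m b a))
  (Fin-length↔ (JLast (suc (a + b)) (suc a)) T-irrelevant (Unique-jacobi312PermsEndingIn (a + b) a b)
     (Equivalence.from (JLast⇔ _ _ _) ∘′ ∈-jacobi312PermsEndingIn⁻ (a + b) a b) complete)
  where
  complete : ∀ {π} → JLast (suc (a + b)) (suc a) π → π ∈ jacobi312PermsEndingIn (a + b) a b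
  complete {π} t with Equivalence.to (JLast⇔ _ _ π) t
  ... | isJ , init , refl with decompose init isJ
  ...   | decomposition {b = b′} m≡ refl adm αJ γJ π≡glue with +-cancelˡ-≡ a b b′ (suc-injective m≡)
  ...     | refl = subst (_∈ _) (sym π≡glue) (∈-jacobi312PermsEndingIn⁺ (a + b) a b (m≤m+n a b) (m≤n+m b a) αJ γJ adm)

evenᵇ-+-odd : ∀ m {n} → T (evenᵇ (suc n)) → evenᵇ (m + n) ≡ evenᵇ (suc m)
evenᵇ-+-odd zero    {n} odd-n with evenᵇ n
... | false = refl
evenᵇ-+-odd (suc m) odd-n = cong not (evenᵇ-+-odd m odd-n)

jlast-same-parity : ∀ m k → k ≢ 1 → evenᵇ m ≡ evenᵇ k → jlast≡ m k 0
jlast-same-parity m k k≢1 same-parity = mk↔ₛ′ (λ ()) (⊥-elim ∘′ impossible) (λ y → ⊥-elim (impossible y)) (λ ())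
  where
  impossible : Σ (List ℕ) (JLast m k) → ⊥
  impossible (π , t) with Equivalence.to (JLast⇔ m k π) t
  ... | isJ , init , refl with decompose init isJ
  ...   | decomposition {zero}  _    refl _   _ _ _ = k≢1 refl
  ...   | decomposition {suc a} {b} refl refl adm _ _ _ =
    not-¬ refl (trans (sym same-parity) (evenᵇ-+-odd (suc (suc a)) adm))

elim-1≤k≤n : ∀ {P : ℕ → ℕ → Set} → (∀ i d → P (suc i + d) (suc i)) → ∀ n k → 1 ≤ k → k ≤ n → P n k
elim-1≤k≤n h n (suc i) _ k≤n with n ∸ suc i | m+[n∸m]≡n k≤n
... | d | refl = h i d

jlast-count-at : ∀ {m k N} a b → suc (a + b) ≡ m → suc a ≡ k → jacobi312LastCount a b ≡ N → jlast≡ m k N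
jlast-count-at a b refl refl refl = jlast-count a b

2[1+i]∸1≡2i+1 : ∀ i → 2 * suc i ∸ 1 ≡ 2 * i + 1
2[1+i]∸1≡2i+1 i = cong (_∸ 1) (lemma i)
  where
  lemma : ∀ i → 2 * suc i ≡ suc (2 * i + 1)
  lemma = solve-∀

3[1+i]∸3≡3i : ∀ i → 3 * suc i ∸ 3 ≡ 3 * i
3[1+i]∸3≡3i i = cong (_∸ 3) (lemma i)
  where
  lemma : ∀ i → 3 * suc i ≡ 3 + 3 * i
  lemma = solve-∀

3[1+i]∸2≡3i+1 : ∀ i → 3 * suc i ∸ 2 ≡ 3 * i + 1
3[1+i]∸2≡3i+1 i = cong (_∸ 2) (lemma i)
  where
  lemma : ∀ i → 3 * suc i ≡ 2 + (3 * i + 1)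
  lemma = solve-∀

c[k+d]∸ck≡cd : ∀ c k d → c * (k + d) ∸ c * k ≡ c * d
c[k+d]∸ck≡cd c k d = trans (sym (*-distribˡ-∸ c (k + d) k)) (cong (c *_) (m+n∸m≡n k d))

[k+d]∸k+1≡1+d : ∀ k d → k + d ∸ k + 1 ≡ suc d
[k+d]∸k+1≡1+d k d = trans (cong (_+ 1) (m+n∸m≡n k d)) (+-comm d 1)

[2k-1][2n-2k+1]≡[2i+1][2d+1] : ∀ i d →
  (2 * suc i ∸ 1) * (2 * (suc i + d) ∸ 2 * suc i + 1) ≡ (2 * i + 1) * (2 * d + 1)
[2k-1][2n-2k+1]≡[2i+1][2d+1] i d = cong₂ _*_ (2[1+i]∸1≡2i+1 i) (cong (_+ 1) (c[k+d]∸ck≡cd 2 (suc i) d))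

C[3n-3k+1,n-k+1]≡C[3d+1,1+d] : ∀ i d →
  (3 * (suc i + d) ∸ 3 * suc i + 1) C (suc i + d ∸ suc i + 1) ≡ (3 * d + 1) C suc d
C[3n-3k+1,n-k+1]≡C[3d+1,1+d] i d = cong₂ _C_ (cong (_+ 1) (c[k+d]∸ck≡cd 3 (suc i) d)) ([k+d]∸k+1≡1+d (suc i) d)

jlast[2n,2k-1] : ∀ n k → 1 ≤ k → k ≤ n →
  jlast≡ (2 * n) (2 * k ∸ 1) (fussCatalan 1 (k ∸ 1) * fussCatalan 2 (n ∸ k))
jlast[2n,2k-1] = elim-1≤k≤n λ i d → jlast-count-at (i + i) (suc (d + d)) (size i d) (cong (_∸ 1) (last-letter i))
  (trans (jacobi312LastCount-odd (i + i) d)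
         (cong₂ _*_ (jacobi312Count-even i) (trans (jacobi312Count-odd d) (cong (fussCatalan 2) (sym (m+n∸m≡n (suc i) d))))))
  where
  size : ∀ i d → suc (i + i + suc (d + d)) ≡ 2 * (suc i + d)
  size = solve-∀
  last-letter : ∀ i → suc (suc (i + i)) ≡ 2 * suc i
  last-letter = solve-∀

jlast[2n+1,2k] : ∀ n k → 1 ≤ k → k ≤ n →
  jlast≡ (2 * n + 1) (2 * k) (fussCatalan 2 (k ∸ 1) * fussCatalan 2 (n ∸ k))
jlast[2n+1,2k] = elim-1≤k≤n λ i d → jlast-count-at (suc (i + i)) (suc (d + d)) (size i d) (last-letter i)
  (trans (jacobi312LastCount-odd (suc (i + i)) d)
         (cong₂ _*_ (jacobi312Count-odd i) (trans (jacobi312Count-odd d) (cong (fussCatalan 2) (sym (m+n∸m≡n (suc i) d))))))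
  where
  size : ∀ i d → suc (suc (i + i) + suc (d + d)) ≡ 2 * (suc i + d) + 1
  size = solve-∀
  last-letter : ∀ i → suc (suc (i + i)) ≡ 2 * suc i
  last-letter = solve-∀

jlast[2n+1,1] : ∀ n → jlast≡ (2 * n + 1) 1 (fussCatalan 1 n)
jlast[2n+1,1] n = jlast-count-at 0 (n + n) (size n) refl (trans (+-identityʳ _) (jacobi312Count-even n))
  where
  size : ∀ n → suc (n + n) ≡ 2 * n + 1
  size = solve-∀

jlast[2n,2k-1]-formula : ∀ n k → 1 ≤ k → k ≤ n →
  fussCatalan 1 (k ∸ 1) * fussCatalan 2 (n ∸ k) * ((2 * k ∸ 1) * (2 * n ∸ 2 * k + 1))
    ≡ ((3 * k ∸ 3) C (k ∸ 1)) * ((3 * n ∸ 3 * k + 1) C (n ∸ k + 1))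
jlast[2n,2k-1]-formula = elim-1≤k≤n λ i d → begin
  fussCatalan 1 i * fussCatalan 2 (suc i + d ∸ suc i) * ((2 * suc i ∸ 1) * (2 * (suc i + d) ∸ 2 * suc i + 1))
    ≡⟨ cong₂ (λ x y → fussCatalan 1 i * fussCatalan 2 x * y) (m+n∸m≡n (suc i) d) ([2k-1][2n-2k+1]≡[2i+1][2d+1] i d) ⟩
  fussCatalan 1 i * fussCatalan 2 d * ((2 * i + 1) * (2 * d + 1))
    ≡⟨ *-interchange (fussCatalan 1 i) (fussCatalan 2 d) (2 * i + 1) (2 * d + 1) ⟩
  fussCatalan 1 i * (2 * i + 1) * (fussCatalan 2 d * (2 * d + 1))
    ≡⟨ cong₂ _*_ (fussCatalan₁-closed i) (fussCatalan₂-closed d) ⟩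
  ((3 * i) C i) * ((3 * d + 1) C suc d)
    ≡⟨ cong₂ _*_ (cong (_C i) (3[1+i]∸3≡3i i)) (C[3n-3k+1,n-k+1]≡C[3d+1,1+d] i d) ⟨
  ((3 * suc i ∸ 3) C (suc i ∸ 1)) * ((3 * (suc i + d) ∸ 3 * suc i + 1) C (suc i + d ∸ suc i + 1)) ∎

jlast[2n+1,2k]-formula : ∀ n k → 1 ≤ k → k ≤ n →
  fussCatalan 2 (k ∸ 1) * fussCatalan 2 (n ∸ k) * ((2 * k ∸ 1) * (2 * n ∸ 2 * k + 1))
    ≡ ((3 * k ∸ 2) C k) * ((3 * n ∸ 3 * k + 1) C (n ∸ k + 1))
jlast[2n+1,2k]-formula = elim-1≤k≤n λ i d → begin
  fussCatalan 2 i * fussCatalan 2 (suc i + d ∸ suc i) * ((2 * suc i ∸ 1) * (2 * (suc i + d) ∸ 2 * suc i + 1))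
    ≡⟨ cong₂ (λ x y → fussCatalan 2 i * fussCatalan 2 x * y) (m+n∸m≡n (suc i) d) ([2k-1][2n-2k+1]≡[2i+1][2d+1] i d) ⟩
  fussCatalan 2 i * fussCatalan 2 d * ((2 * i + 1) * (2 * d + 1))
    ≡⟨ *-interchange (fussCatalan 2 i) (fussCatalan 2 d) (2 * i + 1) (2 * d + 1) ⟩
  fussCatalan 2 i * (2 * i + 1) * (fussCatalan 2 d * (2 * d + 1))
    ≡⟨ cong₂ _*_ (fussCatalan₂-closed i) (fussCatalan₂-closed d) ⟩
  ((3 * i + 1) C suc i) * ((3 * d + 1) C suc d)
    ≡⟨ cong₂ _*_ (cong (_C suc i) (3[1+i]∸2≡3i+1 i)) (C[3n-3k+1,n-k+1]≡C[3d+1,1+d] i d) ⟨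
  ((3 * suc i ∸ 2) C suc i) * ((3 * (suc i + d) ∸ 3 * suc i + 1) C (suc i + d ∸ suc i + 1)) ∎

theorem4p8 : ((n k : ℕ) → 1 ≤ k → k ≤ n →
                  (∃ λ N → jlast≡ (2 * n) (2 * k ∸ 1) N
                      × N * ((2 * k ∸ 1) * (2 * n ∸ 2 * k + 1)) ≡ ((3 * k ∸ 3) C (k ∸ 1)) * ((3 * n ∸ 3 * k + 1) C (n ∸ k + 1)))
                × (∃ λ N → jlast≡ (2 * n + 1) (2 * k) N
                      × N * ((2 * k ∸ 1) * (2 * n ∸ 2 * k + 1)) ≡ ((3 * k ∸ 2) C k) * ((3 * n ∸ 3 * k + 1) C (n ∸ k + 1))))
             × ((n : ℕ) → ∃ λ N → jlast≡ (2 * n + 1) 1 N × N * (2 * n + 1) ≡ (3 * n) C n)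
             × ((m k : ℕ) → k ≢ 1 → evenᵇ m ≡ evenᵇ k → jlast≡ m k 0)
theorem4p8 =
  (λ n k 1≤k k≤n →
     (_ , jlast[2n,2k-1] n k 1≤k k≤n , jlast[2n,2k-1]-formula n k 1≤k k≤n) ,
     (_ , jlast[2n+1,2k] n k 1≤k k≤n , jlast[2n+1,2k]-formula n k 1≤k k≤n)) ,
  (λ n → _ , jlast[2n+1,1] n , fussCatalan₁-closed n) ,
  jlast-same-parity
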